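{- Let $G_1=(V_1,E_1)$ and $G_2=(V_2,E_2)$ be two graphs with clique number at least $r\in\mathbb{N}$. Then for every $r$-gluing $G_1\cup_{K_r}G_2$ of $G_1$ and $G_2$, $$\gamma_{sp}(G_1)+\gamma_{sp}(G_2)-r\leq\gamma_{sp}(G_1\cup_{K_r}G_2)\leq\gamma_{sp}(G_1)+\gamma_{sp}(G_2).$$
   Context: All graphs are finite, simple, undirected; $\mathbb{N}=\{1,2,\dots\}$. For $S\subseteq V(G)$, $\overline{S}=V(G)\setminus S$ and $N(v)$ denotes the open neighbourhood of $v$. A set $S$ is a super dominating set of $G$ if every vertex of $\overline{S}$ has a neighbour in $S$ and for every $u\in\overline{S}$ there is $v\in S$ with $N(v)\cap\overline{S}=\{u\}$. The super domination number $\gamma_{sp}(G)$ is the minimum cardinality of a super dominating set of $G$. Given $r\leq\min\{\omega(G_1),\omega(G_2)\}$ (clique numbers), an $r$-gluing $G_1\cup_{K_r}G_2$ is a graph obtained from the disjoint union of $G_1$ and $G_2$ by choosing an $r$-clique in each of $G_1$ and $G_2$ and identifying the two chosen $r$-cliques vertex-by-vertex in an arbitrary manner. -}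

module Defs where

open import Data.Nat using (ℕ; _+_; _≤_)
open import Data.Bool using (Bool; true; false)
open import Data.Fin using (Fin)
open import Data.Fin.Subset using (Subset; _∈_; _∉_; ∣_∣)
open import Data.Product using (Σ; ∃; _×_; _,_)
open import Data.Sum using (_⊎_)
open import Relation.Binary.PropositionalEquality using (_≡_; _≢_)
open import Function.Definitions using (Injective)

record Graph : Set where
  field
    n     : ℕ
    Adj   : Fin n → Fin n → Bool
    sym   : ∀ u v → Adj u v ≡ Adj v u
    irref : ∀ u → Adj u u ≡ false
open Graph public

Adjacent : (G : Graph) → Fin (n G) → Fin (n G) → Set
Adjacent G u v = Adj G u v ≡ true

IsSuperDominating : (G : Graph) → Subset (n G) → Set
IsSuperDominating G S =
  (∀ u → u ∉ S → Σ (Fin (n G)) λ v → v ∈ S × Adjacent G v u)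
  × (∀ u → u ∉ S → Σ (Fin (n G)) λ v → v ∈ S
        × Adjacent G v u
        × (∀ w → w ∉ S → Adjacent G v w → w ≡ u))

IsSuperDominationNumber : (G : Graph) → ℕ → Set
IsSuperDominationNumber G k =
  (Σ (Subset (n G)) λ S → IsSuperDominating G S × ∣ S ∣ ≡ k)
  × (∀ S → IsSuperDominating G S → k ≤ ∣ S ∣)

record Clique (r : ℕ) (G : Graph) : Set where
  field
    vtx      : Fin r → Fin (n G)
    injective : Injective _≡_ _≡_ vtx
    adjacent : ∀ i j → i ≢ j → Adjacent G (vtx i) (vtx j)
open Clique public

-- Stated up to isomorphism: H contains
-- induced copies ι₁(G₁), ι₂(G₂) covering all vertices, every edge of H lies
-- in one of the copies, and the copies overlap exactly in ι₁(C₁ i) = ι₂(C₂ i).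
record IsGluing (r : ℕ) (G₁ G₂ : Graph) (C₁ : Clique r G₁) (C₂ : Clique r G₂)
                (H : Graph) : Set where
  field
    ι₁      : Fin (n G₁) → Fin (n H)
    ι₂      : Fin (n G₂) → Fin (n H)
    ι₁-inj  : Injective _≡_ _≡_ ι₁
    ι₂-inj  : Injective _≡_ _≡_ ι₂
    ι₁-adj  : ∀ x y → Adj H (ι₁ x) (ι₁ y) ≡ Adj G₁ x y
    ι₂-adj  : ∀ x y → Adj H (ι₂ x) (ι₂ y) ≡ Adj G₂ x y
    cover   : ∀ v → (Σ (Fin (n G₁)) λ x → ι₁ x ≡ v) ⊎ (Σ (Fin (n G₂)) λ y → ι₂ y ≡ v)
    edges   : ∀ u v → Adjacent H u v →
               (Σ (Fin (n G₁)) λ x → Σ (Fin (n G₁)) λ y → ι₁ x ≡ u × ι₁ y ≡ v)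
             ⊎ (Σ (Fin (n G₂)) λ x → Σ (Fin (n G₂)) λ y → ι₂ x ≡ u × ι₂ y ≡ v)
    glue    : ∀ i → ι₁ (vtx C₁ i) ≡ ι₂ (vtx C₂ i)
    meet    : ∀ x y → ι₁ x ≡ ι₂ y → Σ (Fin r) λ i → vtx C₁ i ≡ x × vtx C₂ i ≡ y

-- Write D for the complement of a super dominating set S and pick for each d ∈ D a vertex of S
-- whose only neighbour in D is d.  This "private matching" determines S, and every private
-- matching arises this way, so γ_sp(G) = |V(G)| − max |D|; together with
-- |V(H)| + r = |V(G₁)| + |V(G₂)| both inequalities become statements about private matchings.
--
-- Lower bound: every pair (d, partner d) of a private matching of H is an edge, so it lies in the
-- copy of G₁ or of G₂, and the pairs lying in a copy form a private matching of that graph.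
--
-- Upper bound: reversing a matching (D ↦ partner(D)) keeps its size.  If some d off the clique
-- has its partner on the clique, that partner sees the whole clique, so D misses the clique and
-- the reversed matching is oriented: off-clique vertices have off-clique partners.  Two oriented
-- matchings glue after keeping D₂ only off the clique and removing from D₁ the clique vertices
-- whose twin is not in D₂, which loses at most one vertex per clique index.

module Submission where

open import Defs hiding (sym)

import Data.Nat.Properties as ℕ
open import Algebra.Properties.CommutativeMonoid.Sum ℕ.+-0-commutativeMonoid
  using (sum; sum-cong-≗; ∑-distrib-+)
open import Algebra.Properties.CommutativeSemigroup ℕ.+-commutativeSemigroup
  using (interchange; xy∙z≈xz∙y)
open import Data.Bool using (if_then_else_)
open import Data.Fin using (Fin; zero; suc; _≟_)
open import Data.Fin.Properties using (any?; 0≢1+n; suc-injective)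
open import Data.Fin.Subset using (Subset; inside; outside; _∈_; _∉_; ∣_∣)
open import Data.Fin.Subset.Properties using (_∈?_)
open import Data.Nat using (ℕ; zero; suc; _+_; _≤_; z≤n)
open import Data.Nat.Properties
  using (≤-refl; ≤-reflexive; ≤-trans; m≤m+n; +-identityʳ; +-comm; +-assoc;
         +-mono-≤; +-monoˡ-≤; +-monoʳ-≤; +-cancelʳ-≤; module ≤-Reasoning)
open import Data.Product using (Σ; ∃; _×_; _,_; proj₁; proj₂)
open import Data.Sum as Sum using (_⊎_; inj₁; inj₂)
open import Data.Unit using (tt)
open import Data.Vec using ([]; _∷_; tabulate)
open import Data.Vec.Properties using (lookup⇒[]=; lookup∘tabulate)
open import Function using (_∘_)
open import Function.Definitions using (Injective)
open import Level using (0ℓ)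
open import Relation.Binary.PropositionalEquality
open import Relation.Nullary using (Dec; yes; no; does; ¬_; contradiction)
open import Relation.Nullary.Decidable using (_×-dec_; _⊎-dec_; toSum; dec-true; decidable-stable)
open import Relation.Unary using (Pred; Decidable; _⊆_; Empty; Universal; ∁; _∩_; _∪_; U)
open import Relation.Unary.Properties using (∁?; _∩?_; _∪?_; U?)

private variable
  A B : Set
  m r k : ℕ
  G G₁ G₂ H : Graph

-- Counting decidable subsets of Fin m

indicator : Dec A → ℕ
indicator a? = if does a? then 1 else 0

indicator-mono : (a? : Dec A) (b? : Dec B) → (A → B) → indicator a? ≤ indicator b?
indicator-mono (yes a) (no ¬b) A→B = contradiction (A→B a) ¬b
indicator-mono (yes _) (yes _) _   = ≤-refl
indicator-mono (no _)  _       _   = z≤n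

indicator-cong : (a? : Dec A) (b? : Dec B) → (A → B) → (B → A) → indicator a? ≡ indicator b?
indicator-cong (yes _) (yes _) _   _   = refl
indicator-cong (no _)  (no _)  _   _   = refl
indicator-cong (yes a) (no ¬b) A→B _   = contradiction (A→B a) ¬b
indicator-cong (no ¬a) (yes b) _   B→A = contradiction (B→A b) ¬a

count : {P : Pred (Fin m) 0ℓ} → Decidable P → ℕ
count P? = sum (indicator ∘ P?)

count-cong : {P Q : Pred (Fin m) 0ℓ} (P? : Decidable P) (Q? : Decidable Q) →
             P ⊆ Q → Q ⊆ P → count P? ≡ count Q?
count-cong P? Q? P⊆Q Q⊆P = sum-cong-≗ (λ i → indicator-cong (P? i) (Q? i) P⊆Q Q⊆P)

count-mono : {P Q : Pred (Fin m) 0ℓ} (P? : Decidable P) (Q? : Decidable Q) →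
             P ⊆ Q → count P? ≤ count Q?
count-mono {m = zero}  P? Q? P⊆Q = z≤n
count-mono {m = suc m} P? Q? P⊆Q =
  +-mono-≤ (indicator-mono (P? zero) (Q? zero) P⊆Q) (count-mono (P? ∘ suc) (Q? ∘ suc) P⊆Q)

count-full : {P : Pred (Fin m) 0ℓ} (P? : Decidable P) → Universal P → count P? ≡ m
count-full {m = zero}  P? all = refl
count-full {m = suc m} P? all with P? zero
... | yes _  = cong suc (count-full (P? ∘ suc) (all ∘ suc))
... | no ¬p₀ = contradiction (all zero) ¬p₀

count-empty : {P : Pred (Fin m) 0ℓ} (P? : Decidable P) → Empty P → count P? ≡ 0
count-empty {m = zero}  P? none = refl
count-empty {m = suc m} P? none with P? zero
... | yes p₀ = contradiction p₀ (none zero)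
... | no _   = count-empty (P? ∘ suc) (none ∘ suc)

count≤ : {P : Pred (Fin m) 0ℓ} (P? : Decidable P) → count P? ≤ m
count≤ P? = ≤-trans (count-mono P? U? _) (≤-reflexive (count-full U? _))

count-∪-∩ : {P Q : Pred (Fin m) 0ℓ} (P? : Decidable P) (Q? : Decidable Q) →
            count (P? ∪? Q?) + count (P? ∩? Q?) ≡ count P? + count Q?
count-∪-∩ P? Q? = begin
  count (P? ∪? Q?) + count (P? ∩? Q?)
    ≡⟨ ∑-distrib-+ (indicator ∘ (P? ∪? Q?)) (indicator ∘ (P? ∩? Q?)) ⟨
  sum (λ i → indicator ((P? ∪? Q?) i) + indicator ((P? ∩? Q?) i))
    ≡⟨ sum-cong-≗ (λ i → pointwise (P? i) (Q? i)) ⟩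
  sum (λ i → indicator (P? i) + indicator (Q? i))
    ≡⟨ ∑-distrib-+ (indicator ∘ P?) (indicator ∘ Q?) ⟩
  count P? + count Q? ∎
  where
  open ≡-Reasoning
  pointwise : (a? : Dec A) (b? : Dec B) →
              indicator (a? ⊎-dec b?) + indicator (a? ×-dec b?) ≡ indicator a? + indicator b?
  pointwise (yes _) (yes _) = refl
  pointwise (yes _) (no _)  = refl
  pointwise (no _)  (yes _) = refl
  pointwise (no _)  (no _)  = refl

count-∪-disjoint : {P Q : Pred (Fin m) 0ℓ} (P? : Decidable P) (Q? : Decidable Q) →
                   Empty (P ∩ Q) → count (P? ∪? Q?) ≡ count P? + count Q?
count-∪-disjoint P? Q? disjoint = begin
  count (P? ∪? Q?)                     ≡⟨ +-identityʳ _ ⟨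
  count (P? ∪? Q?) + 0                 ≡⟨ cong (count (P? ∪? Q?) +_) (count-empty (P? ∩? Q?) disjoint) ⟨
  count (P? ∪? Q?) + count (P? ∩? Q?)  ≡⟨ count-∪-∩ P? Q? ⟩
  count P? + count Q?                  ∎
  where open ≡-Reasoning

count-∪-≤ : {P Q : Pred (Fin m) 0ℓ} (P? : Decidable P) (Q? : Decidable Q) →
            count (P? ∪? Q?) ≤ count P? + count Q?
count-∪-≤ P? Q? = ≤-trans (m≤m+n _ _) (≤-reflexive (count-∪-∩ P? Q?))

count-disjoint-≤ : {P Q : Pred (Fin m) 0ℓ} (P? : Decidable P) (Q? : Decidable Q) →
                   Empty (P ∩ Q) → count P? + count Q? ≤ m
count-disjoint-≤ P? Q? disjoint =
  ≤-trans (≤-reflexive (sym (count-∪-disjoint P? Q? disjoint))) (count≤ (P? ∪? Q?))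

count-∁ : {P : Pred (Fin m) 0ℓ} (P? : Decidable P) → count P? + count (∁? P?) ≡ m
count-∁ {m} P? = begin
  count P? + count (∁? P?)                   ≡⟨ count-∪-∩ P? (∁? P?) ⟨
  count (P? ∪? ∁? P?) + count (P? ∩? ∁? P?)  ≡⟨ cong₂ _+_ (count-full (P? ∪? ∁? P?) (toSum ∘ P?))
                                                          (count-empty (P? ∩? ∁? P?) (λ _ (p , ¬p) → ¬p p)) ⟩
  m + 0                                      ≡⟨ +-identityʳ m ⟩
  m                                          ∎
  where open ≡-Reasoning

count-split : {P Q : Pred (Fin m) 0ℓ} (P? : Decidable P) (Q? : Decidable Q) →
              count P? ≡ count (P? ∩? ∁? Q?) + count (P? ∩? Q?)
count-split {P = P} {Q} P? Q? =
  trans (count-cong P? ((P? ∩? ∁? Q?) ∪? (P? ∩? Q?)) split Sum.[ proj₁ , proj₁ ])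
        (count-∪-disjoint (P? ∩? ∁? Q?) (P? ∩? Q?) λ _ ((_ , ¬q) , (_ , q)) → ¬q q)
  where
  split : P ⊆ ((P ∩ ∁ Q) ∪ (P ∩ Q))
  split {i} p = Sum.map (p ,_) (p ,_) (Sum.swap (toSum (Q? i)))

count-singleton : ∀ {m} (a : Fin m) → count (a ≟_) ≡ 1
count-singleton {suc m} zero = cong suc (count-empty {m = m} ((zero ≟_) ∘ suc) (λ _ → 0≢1+n))
count-singleton (suc a) =
  trans (count-cong ((suc a ≟_) ∘ suc) (a ≟_) suc-injective (cong suc)) (count-singleton a)

count-guarded-singleton : (a? : Dec A) (b : Fin m) → count (λ y → a? ×-dec b ≟ y) ≡ indicator a?
count-guarded-singleton (yes a) b =
  trans (count-cong (λ y → yes a ×-dec b ≟ y) (b ≟_) proj₂ (a ,_)) (count-singleton b)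
count-guarded-singleton (no ¬a) b = count-empty (λ y → no ¬a ×-dec b ≟ y) (λ _ → ¬a ∘ proj₁)

Image : ∀ {a b} → (Fin a → Fin b) → Pred (Fin a) 0ℓ → Pred (Fin b) 0ℓ
Image f P y = ∃ λ x → P x × f x ≡ y

Image? : ∀ {a b} (f : Fin a → Fin b) {P : Pred (Fin a) 0ℓ} → Decidable P → Decidable (Image f P)
Image? f P? y = any? (λ x → P? x ×-dec f x ≟ y)

count-Image : ∀ {a b} (f : Fin a → Fin b) {P : Pred (Fin a) 0ℓ} (P? : Decidable P) →
              (∀ {x y} → P x → P y → f x ≡ f y → x ≡ y) → count (Image? f P?) ≡ count P?
count-Image {zero}  f P? injective = count-empty (Image? f P?) (λ _ ())
count-Image {suc a} f {P} P? injective = begin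
  count (Image? f P?)
    ≡⟨ count-cong (Image? f P?) (first? ∪? Image? (f ∘ suc) (P? ∘ suc)) split join ⟩
  count (first? ∪? Image? (f ∘ suc) (P? ∘ suc))
    ≡⟨ count-∪-disjoint first? (Image? (f ∘ suc) (P? ∘ suc)) disjoint ⟩
  count first? + count (Image? (f ∘ suc) (P? ∘ suc))
    ≡⟨ cong₂ _+_ (count-guarded-singleton (P? zero) (f zero))
                 (count-Image (f ∘ suc) (P? ∘ suc) (λ p q → suc-injective ∘ injective p q)) ⟩
  count P? ∎
  where
  open ≡-Reasoning
  First : Pred _ 0ℓ
  First y = P zero × f zero ≡ y
  first? : Decidable First
  first? y = P? zero ×-dec f zero ≟ y
  split : Image f P ⊆ (First ∪ Image (f ∘ suc) (P ∘ suc))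
  split (zero  , p , e) = inj₁ (p , e)
  split (suc x , p , e) = inj₂ (x , p , e)
  join : (First ∪ Image (f ∘ suc) (P ∘ suc)) ⊆ Image f P
  join (inj₁ (p , e))     = zero , p , e
  join (inj₂ (x , p , e)) = suc x , p , e
  disjoint : Empty (First ∩ Image (f ∘ suc) (P ∘ suc))
  disjoint _ ((p₀ , e₀) , (x , p , e)) = 0≢1+n (injective p₀ p (trans e₀ (sym e)))

count-range : ∀ {a} (f : Fin a → Fin m) → Injective _≡_ _≡_ f → count (Image? f U?) ≡ a
count-range f injective = trans (count-Image f U? (λ _ _ → injective)) (count-full U? _)

count-∩-Image : ∀ {a} (c : Fin a → Fin m) → Injective _≡_ _≡_ c →
                {Q : Pred (Fin m) 0ℓ} (Q? : Decidable Q) {P : Pred (Fin a) 0ℓ} (P? : Decidable P) →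
                count (Q? ∩? Image? c P?) ≡ count ((Q? ∘ c) ∩? P?)
count-∩-Image c injective {Q} Q? {P} P? =
  trans (count-cong (Q? ∩? Image? c P?) (Image? c ((Q? ∘ c) ∩? P?)) to from)
        (count-Image c ((Q? ∘ c) ∩? P?) (λ _ _ → injective))
  where
  to : (Q ∩ Image c P) ⊆ Image c ((Q ∘ c) ∩ P)
  to (q , x , p , refl) = x , (q , p) , refl
  from : Image c ((Q ∘ c) ∩ P) ⊆ (Q ∩ Image c P)
  from (x , (q , p) , refl) = q , x , p , refl

∣∣≡count-∈ : (S : Subset m) → ∣ S ∣ ≡ count (_∈? S)
∣∣≡count-∈ []            = refl
∣∣≡count-∈ (inside  ∷ S) = cong suc (∣∣≡count-∈ S)
∣∣≡count-∈ (outside ∷ S) = ∣∣≡count-∈ S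

toSubset : {P : Pred (Fin m) 0ℓ} → Decidable P → Subset m
toSubset P? = tabulate (does ∘ P?)

P⇒∈toSubset : {P : Pred (Fin m) 0ℓ} (P? : Decidable P) → ∀ {i} → P i → i ∈ toSubset P?
P⇒∈toSubset P? {i} p = lookup⇒[]= i _ (trans (lookup∘tabulate _ i) (dec-true (P? i) p))

∣toSubset∣ : {P : Pred (Fin m) 0ℓ} (P? : Decidable P) → ∣ toSubset P? ∣ ≡ count P?
∣toSubset∣ {m = zero}  P? = refl
∣toSubset∣ {m = suc m} P? with P? zero
... | yes _ = cong suc (∣toSubset∣ (P? ∘ suc))
... | no _  = ∣toSubset∣ (P? ∘ suc)

choose : {P : Pred (Fin m) 0ℓ} → Decidable P → Fin m → Fin m
choose P? default with any? P?
... | yes (i , _) = i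
... | no _        = default

choose-correct : {P : Pred (Fin m) 0ℓ} (P? : Decidable P) (default : Fin m) → ∃ P → P (choose P? default)
choose-correct P? default p with any? P?
... | yes (_ , q) = q
... | no ¬p       = contradiction p ¬p

-- Private matchings and super dominating sets

adjacent-sym : (G : Graph) {u v : Fin (n G)} → Adjacent G u v → Adjacent G v u
adjacent-sym G {u} {v} uv = trans (Graph.sym G v u) uv

PrivateNeighbour : (G : Graph) → Pred (Fin (n G)) 0ℓ → Fin (n G) → Fin (n G) → Set
PrivateNeighbour G D d w = ¬ D w × Adjacent G w d × (∀ {e} → D e → Adjacent G w e → e ≡ d)

-- D is the complement of a super dominating set S, and partner d ∈ S has N(partner d) ∖ S = {d}.
record PrivateMatching (G : Graph) : Set₁ where
  field
    D               : Pred (Fin (n G)) 0ℓ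
    D?              : Decidable D
    partner         : Fin (n G) → Fin (n G)
    partner-private : ∀ {d} → D d → PrivateNeighbour G D d (partner d)

  size : ℕ
  size = count D?

  partner∉D : ∀ {d} → D d → ¬ D (partner d)
  partner∉D = proj₁ ∘ partner-private

  partner-adj : ∀ {d} → D d → Adjacent G (partner d) d
  partner-adj = proj₁ ∘ proj₂ ∘ partner-private

  partner-unique : ∀ {d e} → D d → D e → Adjacent G (partner d) e → e ≡ d
  partner-unique dd = proj₂ (proj₂ (partner-private dd))

  partner-injective : ∀ {d e} → D d → D e → partner d ≡ partner e → d ≡ e
  partner-injective dd de pd≡pe =
    sym (partner-unique dd de (subst (λ v → Adjacent G v _) (sym pd≡pe) (partner-adj de)))

open PrivateMatching

fromSuperDominating : (G : Graph) (S : Subset (n G)) → IsSuperDominating G S →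
                      Σ (PrivateMatching G) λ M → ∣ S ∣ + size M ≡ n G
fromSuperDominating G S (_ , privateNeighbour) = M , size-eq
  where
  witness : ∀ u → Dec (u ∈ S) → Fin (n G)
  witness u (yes _)  = u
  witness u (no u∉S) = proj₁ (privateNeighbour u u∉S)

  witness-correct : ∀ {u} → u ∉ S → (u∈?S : Dec (u ∈ S)) → let v = witness u u∈?S in
                    v ∈ S × Adjacent G v u × (∀ w → w ∉ S → Adjacent G v w → w ≡ u)
  witness-correct u∉S (yes u∈S) = contradiction u∈S u∉S
  witness-correct _   (no u∉S)  = proj₂ (privateNeighbour _ u∉S)

  M : PrivateMatching G
  M = record
    { D               = _∉ S
    ; D?              = ∁? (_∈? S)
    ; partner         = λ u → witness u (u ∈? S)
    ; partner-private = λ u∉S → let v∈S , vu , unique = witness-correct u∉S (_ ∈? S) in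
                          (λ v∉S → v∉S v∈S) , vu , unique _
    }

  size-eq : ∣ S ∣ + count (∁? (_∈? S)) ≡ n G
  size-eq = trans (cong (_+ count (∁? (_∈? S))) (∣∣≡count-∈ S)) (count-∁ (_∈? S))

toSuperDominating : (G : Graph) (M : PrivateMatching G) →
                    Σ (Subset (n G)) λ S → IsSuperDominating G S × ∣ S ∣ + size M ≡ n G
toSuperDominating G M = S , (dominating , privateNeighbour) , size-eq
  where
  S = toSubset (∁? (D? M))

  ∉S⇒D : ∀ {u} → u ∉ S → D M u
  ∉S⇒D {u} u∉S = decidable-stable (D? M u) (u∉S ∘ P⇒∈toSubset (∁? (D? M)))

  privateNeighbour : ∀ u → u ∉ S → Σ (Fin (n G)) λ v → v ∈ S × Adjacent G v u
                       × (∀ w → w ∉ S → Adjacent G v w → w ≡ u)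
  privateNeighbour u u∉S =
    partner M u , P⇒∈toSubset (∁? (D? M)) (partner∉D M du) , partner-adj M du ,
    λ w w∉S → partner-unique M du (∉S⇒D w∉S)
    where du = ∉S⇒D u∉S

  dominating : ∀ u → u ∉ S → Σ (Fin (n G)) λ v → v ∈ S × Adjacent G v u
  dominating u u∉S = let v , v∈S , vu , _ = privateNeighbour u u∉S in v , v∈S , vu

  size-eq : ∣ S ∣ + size M ≡ n G
  size-eq = trans (cong (_+ size M) (∣toSubset∣ (∁? (D? M))))
                  (trans (+-comm _ (size M)) (count-∁ (D? M)))

optimalMatching : IsSuperDominationNumber G k → Σ (PrivateMatching G) λ M → k + size M ≡ n G
optimalMatching {G} ((S , sd , refl) , _) = fromSuperDominating G S sd

matching-bound : IsSuperDominationNumber G k → (M : PrivateMatching G) → k + size M ≤ n G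
matching-bound {G} (_ , minimal) M with toSuperDominating G M
... | S , sd , eq = ≤-trans (+-monoˡ-≤ (size M) (minimal S sd)) (≤-reflexive eq)

restrict : (M : PrivateMatching G) {Q : Pred (Fin (n G)) 0ℓ} → Decidable Q → PrivateMatching G
restrict M {Q} Q? = record
  { D               = D M ∩ ∁ Q
  ; D?              = D? M ∩? ∁? Q?
  ; partner         = partner M
  ; partner-private = λ (dd , _) → let p∉D , p~d , unique = partner-private M dd in
                        p∉D ∘ proj₁ , p~d , unique ∘ proj₁
  }

module Reverse {G : Graph} (M : PrivateMatching G) where

  back : Fin (n G) → Fin (n G)
  back y = choose (λ d → D? M d ×-dec partner M d ≟ y) y

  back-correct : ∀ {y} → Image (partner M) (D M) y → D M (back y) × partner M (back y) ≡ y
  back-correct {y} = choose-correct (λ d → D? M d ×-dec partner M d ≟ y) y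

  reverse : PrivateMatching G
  reverse = record
    { D               = Image (partner M) (D M)
    ; D?              = Image? (partner M) (D? M)
    ; partner         = back
    ; partner-private = λ y∈D → let db , pb≡y = back-correct y∈D in
        (λ (d , dd , pd≡back) → partner∉D M dd (subst (D M) (sym pd≡back) db)) ,
        subst (Adjacent G (back _)) pb≡y (adjacent-sym G (partner-adj M db)) ,
        λ { (e , de , refl) back~pe →
              trans (cong (partner M) (sym (partner-unique M de db (adjacent-sym G back~pe)))) pb≡y }
    }

  size-reverse : size reverse ≡ size M
  size-reverse = count-Image (partner M) (D? M) (partner-injective M)

open Reverse using (reverse; size-reverse; back-correct)

-- Cliques and orientation

OnClique : Clique r G → Pred (Fin (n G)) 0ℓ
OnClique C = Image (vtx C) U

onClique? : (C : Clique r G) → Decidable (OnClique C)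
onClique? C = Image? (vtx C) U?

onClique-unique : (M : PrivateMatching G) (C : Clique r G) → ∀ {d e} → D M d →
                  OnClique C (partner M d) → D M e → OnClique C e → e ≡ d
onClique-unique {G = G} M C dd (i , _ , cᵢ≡pd) de (j , _ , refl) with i ≟ j
... | yes refl = contradiction (subst (D M) cᵢ≡pd de) (partner∉D M dd)
... | no i≢j   = partner-unique M dd de (subst (λ v → Adjacent G v (vtx C j)) cᵢ≡pd (adjacent C i j i≢j))

clique-index-unique : (M : PrivateMatching G) (C : Clique r G) {a i : Fin r} → D M (vtx C a) →
                      OnClique C (partner M (vtx C a)) → D M (vtx C i) → i ≡ a
clique-index-unique M C {i = i} da pa∈C di = injective C (onClique-unique M C da pa∈C di (i , tt , refl))

Oriented : Clique r G → PrivateMatching G → Set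
Oriented C M = ∀ {d} → D M d → ¬ OnClique C d → ¬ OnClique C (partner M d)

reverse-oriented : (M : PrivateMatching G) (C : Clique r G) →
                   (∀ {d} → D M d → OnClique C d → OnClique C (partner M d)) → Oriented C (reverse M)
reverse-oriented M C co-oriented y∈D y∉C back∈C =
  let db , pb≡y = back-correct M y∈D in y∉C (subst (OnClique C) pb≡y (co-oriented db back∈C))

orient : (C : Clique r G) (M : PrivateMatching G) →
         Σ (PrivateMatching G) λ M′ → Oriented C M′ × size M′ ≡ size M
orient C M with any? (λ d → D? M d ×-dec ∁? (onClique? C) d ×-dec onClique? C (partner M d))
... | yes (d , dd , d∉C , pd∈C) =
  reverse M , reverse-oriented M C noD-onClique , size-reverse M
  where
  noD-onClique : ∀ {e} → D M e → OnClique C e → OnClique C (partner M e)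
  noD-onClique de e∈C = contradiction (subst (OnClique C) (onClique-unique M C dd pd∈C de e∈C) e∈C) d∉C
... | no ¬bad = M , (λ dd d∉C pd∈C → ¬bad (_ , dd , d∉C , pd∈C)) , refl

-- Restricting along an induced embedding

module Pullback {G H : Graph} (ι : Fin (n G) → Fin (n H)) (ι-injective : Injective _≡_ _≡_ ι)
                (ι-adj : ∀ x y → Adj H (ι x) (ι y) ≡ Adj G x y) (M : PrivateMatching H) where

  Dι : Pred (Fin (n G)) 0ℓ
  Dι x = D M (ι x) × ∃ (λ w → ι w ≡ partner M (ι x))

  partnerι : Fin (n G) → Fin (n G)
  partnerι x = choose (λ w → ι w ≟ partner M (ι x)) x

  ι-partnerι : ∀ {x} → Dι x → ι (partnerι x) ≡ partner M (ι x)
  ι-partnerι {x} (_ , inRange) = choose-correct (λ w → ι w ≟ partner M (ι x)) x inRange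

  pullback : PrivateMatching G
  pullback = record
    { D               = Dι
    ; D?              = λ x → D? M (ι x) ×-dec any? (λ w → ι w ≟ partner M (ι x))
    ; partner         = partnerι
    ; partner-private = λ {x} dx →
        (λ (dpx , _) → partner∉D M (proj₁ dx) (subst (D M) (ι-partnerι dx) dpx)) ,
        trans (sym (ι-adj (partnerι x) x))
              (subst (λ v → Adjacent H v (ι x)) (sym (ι-partnerι dx)) (partner-adj M (proj₁ dx))) ,
        λ {y} dy xy → ι-injective (partner-unique M (proj₁ dx) (proj₁ dy)
                        (subst (λ v → Adjacent H v (ι y)) (ι-partnerι dx) (trans (ι-adj (partnerι x) y) xy)))
    }

open Pullback using (pullback)

-- Gluings

swap : {C₁ : Clique r G₁} {C₂ : Clique r G₂} → IsGluing r G₁ G₂ C₁ C₂ H → IsGluing r G₂ G₁ C₂ C₁ H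
swap gl = record
  { ι₁ = ι₂ ; ι₂ = ι₁ ; ι₁-inj = ι₂-inj ; ι₂-inj = ι₁-inj
  ; ι₁-adj = ι₂-adj ; ι₂-adj = ι₁-adj
  ; cover = Sum.swap ∘ cover
  ; edges = λ u v → Sum.swap ∘ edges u v
  ; glue  = sym ∘ glue
  ; meet  = λ x y e → let i , cᵢ≡y , cᵢ≡x = meet y x (sym e) in i , cᵢ≡x , cᵢ≡y
  }
  where open IsGluing gl

module _ {C₁ : Clique r G₁} {C₂ : Clique r G₂} (gl : IsGluing r G₁ G₂ C₁ C₂ H) where
  open IsGluing gl

  gluing-order : n H + r ≡ n G₁ + n G₂
  gluing-order = begin
    n H + r
      ≡⟨ cong₂ _+_ (count-full (range₁ ∪? range₂) covered)
                   (trans (count-cong (range₁ ∩? range₂) (Image? κ U?) to from) (count-range κ κ-injective)) ⟨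
    count (range₁ ∪? range₂) + count (range₁ ∩? range₂)
      ≡⟨ count-∪-∩ range₁ range₂ ⟩
    count range₁ + count range₂
      ≡⟨ cong₂ _+_ (count-range ι₁ ι₁-inj) (count-range ι₂ ι₂-inj) ⟩
    n G₁ + n G₂ ∎
    where
    open ≡-Reasoning
    range₁ = Image? ι₁ U?
    range₂ = Image? ι₂ U?
    κ = ι₁ ∘ vtx C₁
    κ-injective : Injective _≡_ _≡_ κ
    κ-injective = injective C₁ ∘ ι₁-inj
    covered : ∀ v → Image ι₁ U v ⊎ Image ι₂ U v
    covered v = Sum.map (λ (x , e) → x , tt , e) (λ (y , e) → y , tt , e) (cover v)
    to : (Image ι₁ U ∩ Image ι₂ U) ⊆ Image κ U
    to ((x , _ , refl) , (y , _ , e)) = let i , cᵢ≡x , _ = meet x y (sym e) in i , tt , cong ι₁ cᵢ≡x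
    from : Image κ U ⊆ (Image ι₁ U ∩ Image ι₂ U)
    from (i , _ , refl) = (vtx C₁ i , tt , refl) , (vtx C₂ i , tt , sym (glue i))

  lowerBound : (M : PrivateMatching H) →
               Σ (PrivateMatching G₁) λ M₁ → Σ (PrivateMatching G₂) λ M₂ → size M ≤ size M₁ + size M₂
  lowerBound M = M₁ , M₂ , (begin
    size M
      ≤⟨ count-mono (D? M) (Image? ι₁ (D? M₁) ∪? Image? ι₂ (D? M₂)) covered ⟩
    count (Image? ι₁ (D? M₁) ∪? Image? ι₂ (D? M₂))
      ≤⟨ count-∪-≤ (Image? ι₁ (D? M₁)) (Image? ι₂ (D? M₂)) ⟩
    count (Image? ι₁ (D? M₁)) + count (Image? ι₂ (D? M₂))
      ≡⟨ cong₂ _+_ (count-Image ι₁ (D? M₁) (λ _ _ → ι₁-inj))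
                   (count-Image ι₂ (D? M₂) (λ _ _ → ι₂-inj)) ⟩
    size M₁ + size M₂ ∎)
    where
    open ≤-Reasoning
    M₁ = pullback ι₁ ι₁-inj ι₁-adj M
    M₂ = pullback ι₂ ι₂-inj ι₂-adj M
    covered : D M ⊆ (Image ι₁ (D M₁) ∪ Image ι₂ (D M₂))
    covered {v} dv with edges (partner M v) v (partner-adj M dv)
    ... | inj₁ (a , b , ιa≡pv , refl) = inj₁ (b , (dv , a , ιa≡pv) , refl)
    ... | inj₂ (a , b , ιa≡pv , refl) = inj₂ (b , (dv , a , ιa≡pv) , refl)

  private-neighbour-lifts : (M : PrivateMatching G₁) {DH : Pred (Fin (n H)) 0ℓ} →
    (∀ {z} → DH (ι₁ z) → D M z) → ∀ {x} → D M x → ¬ OnClique C₁ (partner M x) →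
    PrivateNeighbour H DH (ι₁ x) (ι₁ (partner M x))
  private-neighbour-lifts M DH⇒D {x} dx p∉C =
    partner∉D M dx ∘ DH⇒D , trans (ι₁-adj p x) (partner-adj M dx) , unique
    where
    p = partner M x
    unique : ∀ {e} → _ → Adjacent H (ι₁ p) e → e ≡ ι₁ x
    unique {e} de p~e with edges (ι₁ p) e p~e
    ... | inj₁ (_ , z , _ , refl) = cong ι₁ (partner-unique M dx (DH⇒D de) (trans (sym (ι₁-adj p z)) p~e))
    ... | inj₂ (a , _ , ιa≡ιp , _) =
      let i , cᵢ≡p , _ = meet p a (sym ιa≡ιp) in contradiction (i , tt , cᵢ≡p) p∉C

module Glue {C₁ : Clique r G₁} {C₂ : Clique r G₂} (gl : IsGluing r G₁ G₂ C₁ C₂ H)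
            (M₁ : PrivateMatching G₁) (M₂ : PrivateMatching G₂)
            (partner₁-off-clique : ∀ {x} → D M₁ x → ¬ OnClique C₁ (partner M₁ x))
            (oriented₂ : Oriented C₂ M₂)
            (D₁⊆D₂-on-clique : ∀ {i} → D M₁ (vtx C₁ i) → D M₂ (vtx C₂ i)) where
  open IsGluing gl

  D₂° : Pred (Fin (n G₂)) 0ℓ
  D₂° = D M₂ ∩ ∁ (OnClique C₂)

  D₂°? : Decidable D₂°
  D₂°? = D? M₂ ∩? ∁? (onClique? C₂)

  DH : Pred (Fin (n H)) 0ℓ
  DH = Image ι₁ (D M₁) ∪ Image ι₂ D₂°

  ι₂-onClique : ∀ {x y} → ι₁ x ≡ ι₂ y → OnClique C₂ y
  ι₂-onClique e = let i , _ , cᵢ≡y = meet _ _ e in i , tt , cᵢ≡y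

  DH-ι₁ : ∀ {z} → DH (ι₁ z) → D M₁ z
  DH-ι₁ (inj₁ (x , dx , e))        = subst (D M₁) (ι₁-inj e) dx
  DH-ι₁ (inj₂ (y , (_ , y∉C) , e)) = contradiction (ι₂-onClique (sym e)) y∉C

  DH-ι₂ : ∀ {z} → DH (ι₂ z) → D M₂ z
  DH-ι₂ (inj₁ (x , dx , e)) =
    let i , cᵢ≡x , cᵢ≡z = meet _ _ e in
    subst (D M₂) cᵢ≡z (D₁⊆D₂-on-clique (subst (D M₁) (sym cᵢ≡x) dx))
  DH-ι₂ (inj₂ (y , (dy , _) , e)) = subst (D M₂) (ι₂-inj e) dy

  partnerH : Fin (n H) → Fin (n H)
  partnerH v with any? (λ x → ι₁ x ≟ v) | cover v
  ... | yes (x , _) | _            = ι₁ (partner M₁ x)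
  ... | no _        | inj₁ (x , _) = ι₁ (partner M₁ x)
  ... | no _        | inj₂ (y , _) = ι₂ (partner M₂ y)

  partnerH-ι₁ : ∀ x → partnerH (ι₁ x) ≡ ι₁ (partner M₁ x)
  partnerH-ι₁ x with any? (λ x′ → ι₁ x′ ≟ ι₁ x) | cover (ι₁ x)
  ... | yes (_ , e) | _ = cong (ι₁ ∘ partner M₁) (ι₁-inj e)
  ... | no ¬found   | _ = contradiction (x , refl) ¬found

  partnerH-ι₂ : ∀ {y} → ¬ OnClique C₂ y → partnerH (ι₂ y) ≡ ι₂ (partner M₂ y)
  partnerH-ι₂ {y} y∉C with any? (λ x → ι₁ x ≟ ι₂ y) | cover (ι₂ y)
  ... | yes (_ , e) | _             = contradiction (ι₂-onClique e) y∉C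
  ... | no ¬found   | inj₁ found    = contradiction found ¬found
  ... | no _        | inj₂ (_ , e) = cong (ι₂ ∘ partner M₂) (ι₂-inj e)

  partnerH-private : ∀ {v} → DH v → PrivateNeighbour H DH v (partnerH v)
  partnerH-private (inj₁ (x , dx , refl)) rewrite partnerH-ι₁ x =
    private-neighbour-lifts gl M₁ DH-ι₁ dx (partner₁-off-clique dx)
  partnerH-private (inj₂ (y , (dy , y∉C) , refl)) rewrite partnerH-ι₂ y∉C =
    private-neighbour-lifts (swap gl) M₂ DH-ι₂ dy (oriented₂ dy y∉C)

  glued : PrivateMatching H
  glued = record
    { D               = DH
    ; D?              = Image? ι₁ (D? M₁) ∪? Image? ι₂ D₂°?
    ; partner         = partnerH
    ; partner-private = partnerH-private
    }

  size-glued : size glued ≡ size M₁ + count D₂°?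
  size-glued = trans (count-∪-disjoint (Image? ι₁ (D? M₁)) (Image? ι₂ D₂°?) disjoint)
                     (cong₂ _+_ (count-Image ι₁ (D? M₁) (λ _ _ → ι₁-inj))
                                (count-Image ι₂ D₂°? (λ _ _ → ι₂-inj)))
    where
    disjoint : Empty (Image ι₁ (D M₁) ∩ Image ι₂ D₂°)
    disjoint _ ((_ , _ , refl) , (_ , (_ , y∉C) , e)) = y∉C (ι₂-onClique (sym e))

Separated : Clique r G₁ → Clique r G₂ → PrivateMatching G₁ → PrivateMatching G₂ → Set
Separated C₁ C₂ M₁ M₂ =
  ∀ {i} → D M₁ (vtx C₁ i) → D M₂ (vtx C₂ i) → ¬ OnClique C₁ (partner M₁ (vtx C₁ i))

upperBound-separated : {C₁ : Clique r G₁} {C₂ : Clique r G₂} → IsGluing r G₁ G₂ C₁ C₂ H →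
  (M₁ : PrivateMatching G₁) (M₂ : PrivateMatching G₂) →
  Oriented C₁ M₁ → Oriented C₂ M₂ → Separated C₁ C₂ M₁ M₂ →
  Σ (PrivateMatching H) λ M → size M₁ + size M₂ ≤ size M + r
upperBound-separated {r} {C₁ = C₁} {C₂} gl M₁ M₂ oriented₁ oriented₂ separated = glued , bound
  where
  twinOutside? : Decidable (λ i → ¬ D M₂ (vtx C₂ i))
  twinOutside? = ∁? (D? M₂ ∘ vtx C₂)

  dropped? : Decidable (Image (vtx C₁) (λ i → ¬ D M₂ (vtx C₂ i)))
  dropped? = Image? (vtx C₁) twinOutside?

  M₁′ = restrict M₁ dropped?

  twin-in-D₂ : ∀ {i} → D M₁′ (vtx C₁ i) → D M₂ (vtx C₂ i)
  twin-in-D₂ {i} (_ , ¬dropped) = decidable-stable (D? M₂ (vtx C₂ i)) (λ ¬d₂ → ¬dropped (i , ¬d₂ , refl))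

  off-clique : ∀ {x} → D M₁′ x → ¬ OnClique C₁ (partner M₁ x)
  off-clique {x} dx′ with onClique? C₁ x
  ... | no x∉C             = oriented₁ (proj₁ dx′) x∉C
  ... | yes (i , _ , refl) = separated (proj₁ dx′) (twin-in-D₂ dx′)

  open Glue gl M₁′ M₂ off-clique oriented₂ twin-in-D₂ using (glued; size-glued; D₂°?)

  bound : size M₁ + size M₂ ≤ size glued + r
  bound = begin
    size M₁ + size M₂
      ≡⟨ cong₂ _+_ (count-split (D? M₁) dropped?) (count-split (D? M₂) (onClique? C₂)) ⟩
    (size M₁′ + count (D? M₁ ∩? dropped?)) + (count D₂°? + count (D? M₂ ∩? onClique? C₂))
      ≡⟨ interchange (size M₁′) _ _ _ ⟩
    (size M₁′ + count D₂°?) + (count (D? M₁ ∩? dropped?) + count (D? M₂ ∩? onClique? C₂))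
      ≡⟨ cong₂ _+_ (sym size-glued) (cong₂ _+_ (count-∩-Image (vtx C₁) (injective C₁) (D? M₁) twinOutside?)
                                               (count-∩-Image (vtx C₂) (injective C₂) (D? M₂) U?)) ⟩
    size glued + (count ((D? M₁ ∘ vtx C₁) ∩? twinOutside?) + count ((D? M₂ ∘ vtx C₂) ∩? U?))
      ≤⟨ +-monoʳ-≤ (size glued) (count-disjoint-≤ ((D? M₁ ∘ vtx C₁) ∩? twinOutside?)
                                                   ((D? M₂ ∘ vtx C₂) ∩? U?)
                                                   (λ _ ((_ , ¬d₂) , (d₂ , _)) → ¬d₂ d₂)) ⟩
    size glued + r ∎
    where open ≤-Reasoning

-- Separation can only fail at an index a with c₁ a ∈ D₁ ∩ D₂ whose G₁-partner lies on the clique;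
-- then c₁ a is the only vertex of D₁ on the clique.  If its G₂-partner is off the clique the roles
-- of G₁ and G₂ can be exchanged; otherwise c₂ a is also alone in D₂ on the clique, and reversing
-- M₁ replaces c₁ a by its partner, whose twin is not in D₂.
upperBound-oriented : {C₁ : Clique r G₁} {C₂ : Clique r G₂} → IsGluing r G₁ G₂ C₁ C₂ H →
  (M₁ : PrivateMatching G₁) (M₂ : PrivateMatching G₂) → Oriented C₁ M₁ → Oriented C₂ M₂ →
  Σ (PrivateMatching H) λ M → size M₁ + size M₂ ≤ size M + r
upperBound-oriented {r} {C₁ = C₁} {C₂} gl M₁ M₂ oriented₁ oriented₂
  with any? (λ a → D? M₁ (vtx C₁ a) ×-dec onClique? C₁ (partner M₁ (vtx C₁ a)))
... | no noInsidePair =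
  upperBound-separated gl M₁ M₂ oriented₁ oriented₂ (λ d₁ _ p∈C → noInsidePair (_ , d₁ , p∈C))
... | yes (a , d₁a , p₁a∈C) with D? M₂ (vtx C₂ a)
...   | no ¬d₂a =
  upperBound-separated gl M₁ M₂ oriented₁ oriented₂
    (λ d₁ d₂ _ → ¬d₂a (subst (D M₂ ∘ vtx C₂) (clique-index-unique M₁ C₁ d₁a p₁a∈C d₁) d₂))
...   | yes d₂a with onClique? C₂ (partner M₂ (vtx C₂ a))
...     | no p₂a∉C =
  let M , bound = upperBound-separated (swap gl) M₂ M₁ oriented₂ oriented₁
                    (λ d₂ d₁ → subst (λ i → ¬ OnClique C₂ (partner M₂ (vtx C₂ i)))
                                     (sym (clique-index-unique M₁ C₁ d₁a p₁a∈C d₁)) p₂a∉C)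
  in M , subst (_≤ size M + r) (+-comm (size M₂) (size M₁)) bound
...     | yes p₂a∈C =
  let M , bound = upperBound-separated gl (reverse M₁) M₂ (reverse-oriented M₁ C₁ co-oriented) oriented₂ separated
  in M , subst (λ s → s + size M₂ ≤ size M + r) (size-reverse M₁) bound
  where
  co-oriented : ∀ {d} → D M₁ d → OnClique C₁ d → OnClique C₁ (partner M₁ d)
  co-oriented d₁ (i , _ , refl) =
    subst (OnClique C₁ ∘ partner M₁ ∘ vtx C₁) (sym (clique-index-unique M₁ C₁ d₁a p₁a∈C d₁)) p₁a∈C
  separated : Separated C₁ C₂ (reverse M₁) M₂
  separated {i} (d , dd , pd≡cᵢ) d₂ _ with clique-index-unique M₂ C₂ d₂a p₂a∈C d₂
  ... | refl = partner∉D M₁ dd (subst (D M₁) (sym pd≡cᵢ) d₁a)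

upperBound : {C₁ : Clique r G₁} {C₂ : Clique r G₂} → IsGluing r G₁ G₂ C₁ C₂ H →
  (M₁ : PrivateMatching G₁) (M₂ : PrivateMatching G₂) →
  Σ (PrivateMatching H) λ M → size M₁ + size M₂ ≤ size M + r
upperBound {r} {C₁ = C₁} {C₂} gl M₁ M₂ =
  let M₁′ , oriented₁ , size₁ = orient C₁ M₁
      M₂′ , oriented₂ , size₂ = orient C₂ M₂
      M , bound = upperBound-oriented gl M₁′ M₂′ oriented₁ oriented₂
  in M , subst₂ (λ s t → s + t ≤ size M + r) size₁ size₂ bound

module _ {C₁ : Clique r G₁} {C₂ : Clique r G₂} (gl : IsGluing r G₁ G₂ C₁ C₂ H)
         {k₁ k₂ k : ℕ} (γ₁ : IsSuperDominationNumber G₁ k₁) (γ₂ : IsSuperDominationNumber G₂ k₂)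
         (γ : IsSuperDominationNumber H k) where
  open ≤-Reasoning

  superDomination-lower : k₁ + k₂ ≤ k + r
  superDomination-lower =
    let M , k+M≡n = optimalMatching γ
        M₁ , M₂ , M≤M₁+M₂ = lowerBound gl M
    in +-cancelʳ-≤ (size M₁ + size M₂) (k₁ + k₂) (k + r) (begin
      (k₁ + k₂) + (size M₁ + size M₂)  ≡⟨ interchange k₁ k₂ (size M₁) (size M₂) ⟩
      (k₁ + size M₁) + (k₂ + size M₂)  ≤⟨ +-mono-≤ (matching-bound γ₁ M₁) (matching-bound γ₂ M₂) ⟩
      n G₁ + n G₂                      ≡⟨ gluing-order gl ⟨
      n H + r                          ≡⟨ cong (_+ r) k+M≡n ⟨
      (k + size M) + r                 ≡⟨ xy∙z≈xz∙y k (size M) r ⟩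
      (k + r) + size M                 ≤⟨ +-monoʳ-≤ (k + r) M≤M₁+M₂ ⟩
      (k + r) + (size M₁ + size M₂)    ∎)

  superDomination-upper : k ≤ k₁ + k₂
  superDomination-upper =
    let M₁ , k₁+M₁≡n₁ = optimalMatching γ₁
        M₂ , k₂+M₂≡n₂ = optimalMatching γ₂
        M , M₁+M₂≤M+r = upperBound gl M₁ M₂
    in +-cancelʳ-≤ (size M + r) k (k₁ + k₂) (begin
      k + (size M + r)                 ≡⟨ +-assoc k (size M) r ⟨
      (k + size M) + r                 ≤⟨ +-monoˡ-≤ r (matching-bound γ M) ⟩
      n H + r                          ≡⟨ gluing-order gl ⟩
      n G₁ + n G₂                      ≡⟨ cong₂ _+_ k₁+M₁≡n₁ k₂+M₂≡n₂ ⟨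
      (k₁ + size M₁) + (k₂ + size M₂)  ≡⟨ interchange k₁ (size M₁) k₂ (size M₂) ⟩
      (k₁ + k₂) + (size M₁ + size M₂)  ≤⟨ +-monoʳ-≤ (k₁ + k₂) M₁+M₂≤M+r ⟩
      (k₁ + k₂) + (size M + r)         ∎)

theorem4p1 : (r : ℕ) (G₁ G₂ : Graph) (C₁ : Clique r G₁) (C₂ : Clique r G₂)
    (H : Graph) → IsGluing r G₁ G₂ C₁ C₂ H →
    (k₁ k₂ k : ℕ) → IsSuperDominationNumber G₁ k₁ → IsSuperDominationNumber G₂ k₂ →
    IsSuperDominationNumber H k →
    (k₁ + k₂ ≤ k + r) × (k ≤ k₁ + k₂)
theorem4p1 r G₁ G₂ C₁ C₂ H gl k₁ k₂ k γ₁ γ₂ γ =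
  superDomination-lower gl γ₁ γ₂ γ , superDomination-upper gl γ₁ γ₂ γ
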